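{- For the canonical model $\mathbb{M}$ and every $\phi\in \mathcal{L}$: (1) $\mathbb{M}, a\Vdash \phi$ iff $\phi\in a$; (2) $\mathbb{M}, x\succ \phi$ iff $\phi\in x$.
   Context: $\mathcal{L}$ is the language $\varphi ::= \bot\mid\top\mid p\mid\varphi\wedge\varphi\mid\varphi\vee\varphi\mid\Box_i\varphi$ ($i$ in a finite set $\mathsf{Ag}$), and $\mathbf{L}$ its minimal normal logic (lattice axioms, $\top\vdash\Box_i\top$, $\Box_ip\wedge\Box_iq\vdash\Box_i(p\wedge q)$, closed under cut, substitution, lattice rules and monotonicity of $\Box_i$). Canonical model: $A$ is the set of lattice filters and $X$ the set of lattice ideals of the Lindenbaum–Tarski algebra of $\mathbf{L}$, $aIx$ iff $a\cap x\neq\varnothing$, $aR_ix$ iff $\Box_iu\in a$ for some $u\in x$; the valuation sets the extension $[\![p]\!]$ (resp. description $(\![p]\!)$) to the set of filters (resp. ideals) containing $p$. With $S^{\uparrow}[B]=\{x\mid\forall a\in B,\ aSx\}$ and $S^{\downarrow}[Y]=\{a\mid\forall x\in Y,\ aSx\}$, the interpretation is $[\![\top]\!]=A$, $(\![\bot]\!)=X$, $[\![\phi\wedge\psi]\!]=[\![\phi]\!]\cap[\![\psi]\!]$, $(\![\phi\vee\psi]\!)=(\![\phi]\!)\cap(\![\psi]\!)$, $[\![\Box_i\phi]\!]=R_i^\downarrow[(\![\phi]\!)]$, descriptions being $I^\uparrow$ of extensions and extensions $I^\downarrow$ of descriptions; $\mathbb{M},a\Vdash\phi$ iff $a\in[\![\phi]\!]$,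 $\mathbb{M},x\succ\phi$ iff $x\in(\![\phi]\!)$. -}

module Defs where

open import Data.Nat using (ℕ)
open import Data.Fin using (Fin)
open import Data.Product using (Σ; _×_)
open import Level using (Lift; 0ℓ; suc)
import Data.Unit.Polymorphic as UP

Lift⊤ : Set₁
Lift⊤ = UP.⊤ {suc 0ℓ}

module Canonical (Atom : Set) (n : ℕ) where

  Ag : Set
  Ag = Fin n

  infixr 6 _∧_
  infixr 5 _∨_
  infix 3 _⊢_

  data Fm : Set where
    ⊥ ⊤  : Fm
    var  : Atom → Fm
    _∧_ _∨_ : Fm → Fm → Fm
    □    : Ag → Fm → Fm

  -- The minimal normal (non-distributive) logic L, as a consequence relation
  -- on formulas.  Axioms are schematic, so closure under substitution is built in.
  data _⊢_ : Fm → Fm → Set where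
    id    : ∀ {φ} → φ ⊢ φ
    cut   : ∀ {φ ψ χ} → φ ⊢ ψ → ψ ⊢ χ → φ ⊢ χ
    ⊥⊢    : ∀ {φ} → ⊥ ⊢ φ
    ⊢⊤    : ∀ {φ} → φ ⊢ ⊤
    ∧-e₁  : ∀ {φ ψ} → φ ∧ ψ ⊢ φ
    ∧-e₂  : ∀ {φ ψ} → φ ∧ ψ ⊢ ψ
    ∧-i   : ∀ {φ ψ χ} → χ ⊢ φ → χ ⊢ ψ → χ ⊢ φ ∧ ψ
    ∨-i₁  : ∀ {φ ψ} → φ ⊢ φ ∨ ψ
    ∨-i₂  : ∀ {φ ψ} → ψ ⊢ φ ∨ ψ
    ∨-e   : ∀ {φ ψ χ} → φ ⊢ χ → ψ ⊢ χ → φ ∨ ψ ⊢ χ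
    □⊤    : ∀ {i} → ⊤ ⊢ □ i ⊤
    □∧    : ∀ {i φ ψ} → □ i φ ∧ □ i ψ ⊢ □ i (φ ∧ ψ)
    □-mono : ∀ {i φ ψ} → φ ⊢ ψ → □ i φ ⊢ □ i ψ

  -- Lattice filters of the Lindenbaum–Tarski algebra, represented as sets of
  -- formulas that contain ⊤, are upward closed under ⊢ (hence closed under
  -- provable equivalence) and closed under ∧.
  record Filter : Set₁ where
    field
      _∋_   : Fm → Set
      has-⊤ : _∋_ ⊤
      up    : ∀ {φ ψ} → _∋_ φ → φ ⊢ ψ → _∋_ ψ
      meet  : ∀ {φ ψ} → _∋_ φ → _∋_ ψ → _∋_ (φ ∧ ψ)

  record Ideal : Set₁ where
    field
      _∋_   : Fm → Set
      has-⊥ : _∋_ ⊥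
      down  : ∀ {φ ψ} → _∋_ ψ → φ ⊢ ψ → _∋_ φ
      join  : ∀ {φ ψ} → _∋_ φ → _∋_ ψ → _∋_ (φ ∨ ψ)

  open Filter using () renaming (_∋_ to _∋ᶠ_) public
  open Ideal  using () renaming (_∋_ to _∋ⁱ_) public

  A : Set₁
  A = Filter

  X : Set₁
  X = Ideal

  I : A → X → Set
  I a x = Σ Fm λ u → (a ∋ᶠ u) × (x ∋ⁱ u)

  R : Ag → A → X → Set
  R i a x = Σ Fm λ u → (x ∋ⁱ u) × (a ∋ᶠ □ i u)

  _↑[_] : (A → X → Set) → (A → Set₁) → X → Set₁
  (S ↑[ B ]) x = ∀ a → B a → S a x

  _↓[_] : (A → X → Set) → (X → Set₁) → A → Set₁
  (S ↓[ Y ]) a = ∀ x → Y x → S a x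

  -- Extensions [[φ]] ⊆ A and descriptions (|φ|) ⊆ X in the canonical model.
  -- (descriptions of ⊤, ∧, □ are I↑ of the corresponding extensions,
  --  extensions of ⊥, ∨ are I↓ of the descriptions; unfolded for termination)
  mutual
    ext : Fm → A → Set₁
    ext ⊥ = I ↓[ (λ _ → Lift⊤) ]
    ext ⊤ = λ _ → Lift⊤
    ext (var p) = λ a → Lift (suc 0ℓ) (a ∋ᶠ var p)
    ext (φ ∧ ψ) = λ a → ext φ a × ext ψ a
    ext (φ ∨ ψ) = I ↓[ (λ x → desc φ x × desc ψ x) ]
    ext (□ i φ) = R i ↓[ desc φ ]

    desc : Fm → X → Set₁
    desc ⊥ = λ _ → Lift⊤
    desc ⊤ = I ↑[ (λ _ → Lift⊤) ]
    desc (var p) = λ x → Lift (suc 0ℓ) (x ∋ⁱ var p)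
    desc (φ ∧ ψ) = I ↑[ (λ a → ext φ a × ext ψ a) ]
    desc (φ ∨ ψ) = λ x → desc φ x × desc ψ x
    desc (□ i φ) = I ↑[ R i ↓[ desc φ ] ]

  _⊩_ : A → Fm → Set₁
  a ⊩ φ = ext φ a

  _≻_ : X → Fm → Set₁
  x ≻ φ = desc φ x

module Submission where

-- Half of each step is direct:
-- extensions of ⊤, atoms, ∧ and descriptions of ⊥, atoms, ∨ are computed
-- componentwise, using that filters contain ⊤ and are ∧-closed and ideals
-- contain ⊥ and are ∨-closed.  The other half comes from three "principal"
-- lemmas proved first.  Each says that a Galois-closure of a truth set is
-- again a truth set, and is witnessed by a principal filter ↑φ or principal
-- ideal ↓φ:
--   * I↑[ [[φ]] ] = {x | φ ∈ x}      (descriptions of ⊤, ∧, □ᵢ),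
--   * I↓[ (|φ|) ] = {a | φ ∈ a}      (extensions of ⊥, ∨),
--   * Rᵢ↓[ (|φ|) ] = {a | □ᵢφ ∈ a}   (extensions of □ᵢ, via monotonicity of □ᵢ).

open import Defs
open import Data.Nat using (ℕ)
open import Function.Bundles using (_⇔_; mk⇔; Equivalence)
open import Data.Product using (_×_; _,_)
open import Level using (Lift; 0ℓ; suc; lift; lower)
import Data.Unit.Polymorphic as UP

module TruthLemma (Atom : Set) (n : ℕ) where
  open Canonical Atom n
  open Equivalence using (to; from)

  ↑_ : Fm → Filter
  ↑ φ = record { _∋_ = λ ψ → φ ⊢ ψ ; has-⊤ = ⊢⊤ ; up = cut ; meet = ∧-i }

  ↓_ : Fm → Ideal
  ↓ φ = record { _∋_ = λ ψ → ψ ⊢ φ ; has-⊥ = ⊥⊢ ; down = λ ψ⊢φ χ⊢ψ → cut χ⊢ψ ψ⊢φ ; join = ∨-e }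

  ExtTruth : Fm → Set₁
  ExtTruth φ = ∀ (a : A) → (a ⊩ φ) ⇔ Lift (suc 0ℓ) (a ∋ᶠ φ)

  DescTruth : Fm → Set₁
  DescTruth φ = ∀ (x : X) → (x ≻ φ) ⇔ Lift (suc 0ℓ) (x ∋ⁱ φ)

  -- If [[φ]] is the set of filters containing φ, then I↑[[[φ]]] is the set of
  -- ideals containing φ: test x against ↑φ ∈ [[φ]], whose meet with x
  -- yields some u ∈ x with φ ⊢ u, so φ ∈ x.
  I↑-principal : ∀ {φ} → ExtTruth φ → ∀ x → (I ↑[ ext φ ]) x ⇔ Lift (suc 0ℓ) (x ∋ⁱ φ)
  I↑-principal {φ} ext-φ x = mk⇔ sound complete
    where
      sound : (I ↑[ ext φ ]) x → Lift (suc 0ℓ) (x ∋ⁱ φ)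
      sound h with h (↑ φ) (from (ext-φ (↑ φ)) (lift id))
      ... | u , φ⊢u , u∈x = lift (Ideal.down x u∈x φ⊢u)

      complete : Lift (suc 0ℓ) (x ∋ⁱ φ) → (I ↑[ ext φ ]) x
      complete φ∈x a a⊩φ = φ , lower (to (ext-φ a) a⊩φ) , lower φ∈x

  -- Dually, if (|φ|) is the set of ideals containing φ, then I↓[(|φ|)] is the
  -- set of filters containing φ, tested against ↓φ ∈ (|φ|).
  I↓-principal : ∀ {φ} → DescTruth φ → ∀ a → (I ↓[ desc φ ]) a ⇔ Lift (suc 0ℓ) (a ∋ᶠ φ)
  I↓-principal {φ} desc-φ a = mk⇔ sound complete
    where
      sound : (I ↓[ desc φ ]) a → Lift (suc 0ℓ) (a ∋ᶠ φ)
      sound h with h (↓ φ) (from (desc-φ (↓ φ)) (lift id))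
      ... | u , u∈a , u⊢φ = lift (Filter.up a u∈a u⊢φ)

      complete : Lift (suc 0ℓ) (a ∋ᶠ φ) → (I ↓[ desc φ ]) a
      complete φ∈a x x≻φ = φ , lower φ∈a , lower (to (desc-φ x) x≻φ)

  -- The modal analogue: Rᵢ↓[(|φ|)] is the set of filters containing □ᵢφ.
  -- Testing against ↓φ gives u ⊢ φ with □ᵢu ∈ a, and □ᵢu ⊢ □ᵢφ by monotonicity.
  R↓-principal : ∀ {i φ} → DescTruth φ → ∀ a → (R i ↓[ desc φ ]) a ⇔ Lift (suc 0ℓ) (a ∋ᶠ □ i φ)
  R↓-principal {i} {φ} desc-φ a = mk⇔ sound complete
    where
      sound : (R i ↓[ desc φ ]) a → Lift (suc 0ℓ) (a ∋ᶠ □ i φ)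
      sound h with h (↓ φ) (from (desc-φ (↓ φ)) (lift id))
      ... | u , u⊢φ , □u∈a = lift (Filter.up a □u∈a (□-mono u⊢φ))

      complete : Lift (suc 0ℓ) (a ∋ᶠ □ i φ) → (R i ↓[ desc φ ]) a
      complete □φ∈a x x≻φ = φ , lower (to (desc-φ x) x≻φ) , lower □φ∈a

  ext-∧ : ∀ {φ ψ} → ExtTruth φ → ExtTruth ψ → ExtTruth (φ ∧ ψ)
  ext-∧ ext-φ ext-ψ a = mk⇔
    (λ (a⊩φ , a⊩ψ) → lift (Filter.meet a (lower (to (ext-φ a) a⊩φ)) (lower (to (ext-ψ a) a⊩ψ))))
    (λ φ∧ψ∈a → from (ext-φ a) (lift (Filter.up a (lower φ∧ψ∈a) ∧-e₁))
             , from (ext-ψ a) (lift (Filter.up a (lower φ∧ψ∈a) ∧-e₂)))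

  desc-∨ : ∀ {φ ψ} → DescTruth φ → DescTruth ψ → DescTruth (φ ∨ ψ)
  desc-∨ desc-φ desc-ψ x = mk⇔
    (λ (x≻φ , x≻ψ) → lift (Ideal.join x (lower (to (desc-φ x) x≻φ)) (lower (to (desc-ψ x) x≻ψ))))
    (λ φ∨ψ∈x → from (desc-φ x) (lift (Ideal.down x (lower φ∨ψ∈x) ∨-i₁))
             , from (desc-ψ x) (lift (Ideal.down x (lower φ∨ψ∈x) ∨-i₂)))

  ext-⊤ : ExtTruth ⊤
  ext-⊤ a = mk⇔ (λ _ → lift (Filter.has-⊤ a)) (λ _ → UP.tt)

  desc-⊥ : DescTruth ⊥
  desc-⊥ x = mk⇔ (λ _ → lift (Ideal.has-⊥ x)) (λ _ → UP.tt)

  ext-var : ∀ p → ExtTruth (var p)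
  ext-var p a = mk⇔ (λ h → h) (λ h → h)

  desc-var : ∀ p → DescTruth (var p)
  desc-var p x = mk⇔ (λ h → h) (λ h → h)

  truth : ∀ φ → ExtTruth φ × DescTruth φ
  truth ⊥       = I↓-principal desc-⊥ , desc-⊥
  truth ⊤       = ext-⊤ , I↑-principal ext-⊤
  truth (var p) = ext-var p , desc-var p
  truth (φ ∧ ψ) with truth φ | truth ψ
  ... | ext-φ , _ | ext-ψ , _ = ext-φ∧ψ , I↑-principal ext-φ∧ψ
    where ext-φ∧ψ = ext-∧ ext-φ ext-ψ
  truth (φ ∨ ψ) with truth φ | truth ψ
  ... | _ , desc-φ | _ , desc-ψ = I↓-principal desc-φ∨ψ , desc-φ∨ψ
    where desc-φ∨ψ = desc-∨ desc-φ desc-ψ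
  truth (□ i φ) with truth φ
  ... | _ , desc-φ = R↓-principal desc-φ , I↑-principal (R↓-principal desc-φ)

lemmaA18 : (Atom : Set) (n : ℕ) → let open Canonical Atom n in
    (φ : Fm) → (∀ (a : A) → (a ⊩ φ) ⇔ Lift (suc 0ℓ) (a ∋ᶠ φ))
             × (∀ (x : X) → (x ≻ φ) ⇔ Lift (suc 0ℓ) (x ∋ⁱ φ))
lemmaA18 Atom n = TruthLemma.truth Atom n
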